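{- Let $n\ge1$. For $a\in[n]$ and $e=e_1\dots e_n\in\mathcal{I}_n(\underline{000})$, define $e_{n+1}=a$ if $a>e_n$ and $e_{n+1}=a-1$ if $a\le e_n$, and let $e'=e_1\dots e_ne_{n+1}$. Then $e'\in\mathcal{I}_{n+1}(\underline{000})$, the map $(a,e)\mapsto e'$ is a bijection from $[n]\times\mathcal{I}_n(\underline{000})$ onto $\{e_1\dots e_{n+1}\in\mathcal{I}_{n+1}(\underline{000}): e_n\ne e_{n+1}\}$, and the map $(a,e)\mapsto\phi(e')$ is a bijection from $[n]\times\mathcal{I}_n(\underline{000})$ onto $\overline{\mathcal{D}}_{n+1}$. Here $\phi$ is the map defined as follows on $\mathcal{I}_m(\underline{000})$ (with $m=n+1$). Definition of $\phi$. Let $e=e_1\dots e_m\in\mathcal{I}_m(\underline{000})$. Form the word $w=w_2\dots w_m$ by setting, for $2\le k\le m$, $w_k=R$ if $e_k=e_{k-1}$, $w_k=e_k$ if $e_k>e_{k-1}$, and $w_k=e_k+1$ if $e_k<e_{k-1}$. Build $\sigma_1,\dots,\sigma_m$, each $\sigma_k$ regarded as an element of $\overline{\mathcal{D}}_k$ if $w_k\ne R$ (and for $k=1$) and of $\overline{\mathcal{D}}_{k-1}$ if $w_k=R$: $\sigma_1=1\in\overline{\mathcal{D}}_1$; for $k=2,\dots,m$, if $w_k=R$ let $\sigma_k=\sigma_{k-1}$; otherwise let $\sigma_k=(w_k,k)\sigma_{k-1}$ if $w_{k-1}\neq R$ (vacuous for $k=2$) and $\sigma_{k-1}\in\overline{\mathcal{D}}_{k-1}$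 has a fixed point different from $w_k$, and $\sigma_k=(w_k,k-1)\sigma_{k-1}$ otherwise, where $\sigma_{k-1}$ is viewed in $\mathcal{S}_k$ and $\sigma_k$ is regarded as an element of $\overline{\mathcal{D}}_k$. Then $\phi(e)=\sigma_m$.
   Context: $\mathcal{S}_m$ is the set of permutations of $[m]=\{1,\dots,m\}$; $\mathcal{S}_{m-1}$ is identified with the permutations in $\mathcal{S}_m$ fixing $m$. $\overline{\mathcal{D}}_m$ denotes the set of permutations in $\mathcal{S}_m$ with at least one fixed point. An inversion sequence of length $m$ is an integer sequence $e_1\dots e_m$ with $0\le e_i<i$ for all $i$; $\mathcal{I}_m(\underline{000})$ is the set of those with no $i$ such that $e_i=e_{i+1}=e_{i+2}$. For $1\le a,b\le m$, $(a,b)\sigma$ denotes the permutation obtained from the one-line notation of $\sigma$ by exchanging the entries $a$ and $b$ (no change if $a=b$). -}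

module Defs where

open import Data.Nat using (ℕ; zero; suc; _+_; _∸_; _≤_; _<_; _≡ᵇ_; _<ᵇ_)
open import Data.Bool using (Bool; true; false; if_then_else_; _∧_; _∨_; not)
open import Data.List using (List; []; _∷_; _++_; length; map; upTo; lookup)
open import Data.List.Relation.Binary.Permutation.Propositional using (_↭_)
open import Data.Fin using (Fin; toℕ)
open import Data.Product using (Σ; ∃; _×_; _,_)
open import Relation.Binary.PropositionalEquality using (_≡_; _≢_)
open import Relation.Nullary using (¬_)

-- Inversion sequences (as lists e₁ … eₘ; list index i (0-based) holds e_{i+1})

IsInvSeq : ℕ → List ℕ → Set
IsInvSeq m e = (length e ≡ m) × (∀ (i : Fin (length e)) → lookup e i < suc (toℕ i))

Has000 : List ℕ → Set
Has000 e = ∃ λ (xs : List ℕ) → ∃ λ (ys : List ℕ) → ∃ λ (x : ℕ) → e ≡ xs ++ (x ∷ x ∷ x ∷ ys)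

I000 : ℕ → List ℕ → Set
I000 m e = IsInvSeq m e × ¬ Has000 e

-- last entry (only used on nonempty lists)
lastℕ : List ℕ → ℕ
lastℕ []           = 0
lastℕ (x ∷ [])     = x
lastℕ (x ∷ y ∷ ys) = lastℕ (y ∷ ys)

ext : ℕ → List ℕ → List ℕ
ext a e = e ++ ((if lastℕ e <ᵇ a then a else a ∸ 1) ∷ [])

LastTwoDistinct : List ℕ → Set
LastTwoDistinct e = ∃ λ (xs : List ℕ) → ∃ λ (x : ℕ) → ∃ λ (y : ℕ) →
  (e ≡ xs ++ (x ∷ y ∷ [])) × (x ≢ y)

-- Permutations in one-line notation (lists of values in [m])

IsPerm : ℕ → List ℕ → Set
IsPerm m σ = σ ↭ map suc (upTo m)

HasFix : List ℕ → Set
HasFix σ = ∃ λ (i : Fin (length σ)) → lookup σ i ≡ suc (toℕ i)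

Dbar : ℕ → List ℕ → Set
Dbar m σ = IsPerm m σ × HasFix σ

-- (a,b)σ : exchange the entries a and b in the one-line notation
swapVal : ℕ → ℕ → ℕ → ℕ
swapVal a b x = if x ≡ᵇ a then b else (if x ≡ᵇ b then a else x)

swapE : ℕ → ℕ → List ℕ → List ℕ
swapE a b σ = map (swapVal a b) σ

-- view σ ∈ S_j (j = length σ) as an element of S_k (j ≤ k) by fixing j+1,…,k
pad : ℕ → List ℕ → List ℕ
pad k σ = σ ++ map (λ i → length σ + suc i) (upTo (k ∸ length σ))

hasFixOtherFrom : ℕ → ℕ → List ℕ → Bool
hasFixOtherFrom x i []       = false
hasFixOtherFrom x i (y ∷ ys) = ((y ≡ᵇ i) ∧ not (i ≡ᵇ x)) ∨ hasFixOtherFrom x (suc i) ys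

hasFixOther : ℕ → List ℕ → Bool
hasFixOther x σ = hasFixOtherFrom x 1 σ

data Letter : Set where
  R   : Letter
  val : ℕ → Letter

letter : ℕ → ℕ → Letter
letter p c = if c ≡ᵇ p then R else (if p <ᵇ c then val c else val (suc c))

isR : Letter → Bool
isR R       = true
isR (val _) = false

step : ℕ → Letter → Letter → List ℕ → List ℕ
step k prev R       σ = σ
step k prev (val x) σ =
  if not (isR prev) ∧ hasFixOther x σ
  then swapE x k (pad k σ)
  else swapE x (k ∸ 1) (pad k σ)

-- phiAux k prev p rest σ : k = index of the next letter, prev = w_{k-1}
-- (val 0 as a dummy "not R" for k = 2), p = e_{k-1}, rest = e_k … e_m,
-- σ = σ_{k-1}
phiAux : ℕ → Letter → ℕ → List ℕ → List ℕ → List ℕ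
phiAux k prev p []       σ = σ
phiAux k prev p (c ∷ cs) σ =
  phiAux (suc k) (letter p c) c cs (step k prev (letter p c) σ)

φ : List ℕ → List ℕ
φ []       = []
φ (e₁ ∷ es) = phiAux 2 (val 0) e₁ es (1 ∷ [])

record BijectionOnto {A B : Set} (P : A → Set) (Q : B → Set) (f : A → B) : Set where
  field
    into : ∀ x → P x → Q (f x)
    inj  : ∀ x y → P x → P y → f x ≡ f y → x ≡ y
    surj : ∀ y → Q y → Σ A (λ x → P x × (f x ≡ y))

Dom : ℕ → ℕ × List ℕ → Set
Dom n (a , e) = (1 ≤ a) × (a ≤ n) × I000 n e

-- One letter w ≠ R of the word of e moves σ_m to σ_{m+1} = grow m (w , b , σ_m), where b says
-- whether the previous letter was R, and accordingly σ_m ∈ D̄_{m-1} or σ_m ∈ D̄_m. This step is a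
-- bijection from [m] × (D̄_{m-1} ⊔ D̄_m) onto D̄_{m+1}: the last entry of σ_{m+1}, and whether undoing
-- the transposition leaves a fixed point, tell which branch of the definition was taken, and the
-- transposition is then undone. Since I_{n+1}(000) consists of the sequences e e_n with e not ending
-- in a repetition (which leave σ unchanged) and of the ext a e, induction on n shows that
-- e ↦ (whether e ends in a repetition, φ e) is a bijection from I_n(000) onto D̄_{n-1} ⊔ D̄_n.
-- Composing with the step gives the bijection (a , e) ↦ φ (ext a e); that ext itself is a bijection
-- onto the sequences whose last two entries differ is read off from the letter w_{n+1} = a.

module Submission where

open import Defs
open import Data.Bool using (Bool; true; false; if_then_else_; _∧_; not; T)
open import Data.Bool.Properties using (∧-assoc; ∧-identityʳ; ∧-zeroʳ; ∨-zeroʳ)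
open import Data.Empty using (⊥; ⊥-elim)
open import Data.Fin using (Fin; toℕ) renaming (zero to fzero; suc to fsuc)
open import Data.List using (List; []; _∷_; _++_; length; map; upTo; lookup; initLast; _∷ʳ′_)
open import Data.List.Properties
  using (length-++; length-map; length-upTo; map-++; upTo-∷ʳ; ++-assoc; ∷ʳ-injective; ∷ʳ-injectiveˡ; ∷ʳ-injectiveʳ)
open import Data.List.Relation.Binary.Permutation.Propositional as ↭ using (_↭_)
open import Data.List.Relation.Binary.Permutation.Propositional.Properties using (shift; ↭-length)
open import Data.Nat using (ℕ; zero; suc; _+_; _∸_; _≤_; _<_; _≡ᵇ_; _<ᵇ_; z≤n; s≤s)
open import Data.Nat.Properties
open import Algebra.Properties.CommutativeSemigroup +-commutativeSemigroup using (x∙yz≈y∙xz)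
open import Data.Product using (Σ; ∃; _×_; _,_; proj₁; proj₂; map₂)
open import Data.Sum using (_⊎_; inj₁; inj₂)
open import Data.Unit using (⊤; tt)
open import Relation.Binary.PropositionalEquality
open import Relation.Nullary using (¬_; Dec; yes; no)
open ≡-Reasoning

BijectionOnto-∘ : ∀ {A B C : Set} {P : A → Set} {Q : B → Set} {S : C → Set} {f : A → B} {g : B → C} →
                  BijectionOnto P Q f → BijectionOnto Q S g → BijectionOnto P S (λ x → g (f x))
BijectionOnto-∘ {A = A} {P = P} {S = S} {f} {g} bf bg = record
  { into = λ x px → G.into (f x) (F.into x px)
  ; inj  = λ x y px py eq → F.inj x y px py (G.inj (f x) (f y) (F.into x px) (F.into y py) eq)
  ; surj = surj
  }
  where
  module F = BijectionOnto bf
  module G = BijectionOnto bg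
  surj : ∀ z → S z → Σ A λ x → P x × g (f x) ≡ z
  surj z rz with G.surj z rz
  ... | y , qy , gy≡z with F.surj y qy
  ...   | x , px , fx≡y = x , px , trans (cong g fx≡y) gy≡z

BijectionOnto-cong : ∀ {A B : Set} {P : A → Set} {Q : B → Set} {f g : A → B} →
                     (∀ x → P x → f x ≡ g x) → BijectionOnto P Q f → BijectionOnto P Q g
BijectionOnto-cong {Q = Q} f≗g bf = record
  { into = λ x px → subst Q (f≗g x px) (F.into x px)
  ; inj  = λ x y px py eq → F.inj x y px py (trans (f≗g x px) (trans eq (sym (f≗g y py))))
  ; surj = λ y qy → let (x , px , fx≡y) = F.surj y qy in x , px , trans (sym (f≗g x px)) fx≡y
  }
  where module F = BijectionOnto bf

BijectionOnto-codomain : ∀ {A B : Set} {P : A → Set} {Q Q′ : B → Set} {f : A → B} →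
                         (∀ y → Q y → Q′ y) → (∀ y → Q′ y → Q y) → BijectionOnto P Q f → BijectionOnto P Q′ f
BijectionOnto-codomain Q⇒Q′ Q′⇒Q bf = record
  { into = λ x px → Q⇒Q′ _ (F.into x px)
  ; inj  = F.inj
  ; surj = λ y q′y → F.surj y (Q′⇒Q y q′y)
  }
  where module F = BijectionOnto bf

data EqView (m n : ℕ) : Set where
  equal    : m ≡ n → (m ≡ᵇ n) ≡ true  → EqView m n
  distinct : m ≢ n → (m ≡ᵇ n) ≡ false → EqView m n

eqView : ∀ m n → EqView m n
eqView m n with m ≡ᵇ n in eq
... | true  = equal (≡ᵇ⇒≡ m n (subst T (sym eq) tt)) eq
... | false = distinct (λ m≡n → subst T eq (≡⇒≡ᵇ m n m≡n)) eq

data LtView (m n : ℕ) : Set where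
  less    : m < n → (m <ᵇ n) ≡ true  → LtView m n
  notLess : n ≤ m → (m <ᵇ n) ≡ false → LtView m n

ltView : ∀ m n → LtView m n
ltView m n with m <ᵇ n in eq
... | true  = less (<ᵇ⇒< m n (subst T (sym eq) tt)) eq
... | false = notLess (≮⇒≥ (λ m<n → subst T eq (<⇒<ᵇ m<n))) eq

≡ᵇ-refl : ∀ n → (n ≡ᵇ n) ≡ true
≡ᵇ-refl zero    = refl
≡ᵇ-refl (suc n) = ≡ᵇ-refl n

≡ᵇ-true⇒≡ : ∀ {m n} → (m ≡ᵇ n) ≡ true → m ≡ n
≡ᵇ-true⇒≡ {m} {n} h = ≡ᵇ⇒≡ m n (subst T (sym h) tt)

≢⇒≡ᵇ-false : ∀ {m n} → m ≢ n → (m ≡ᵇ n) ≡ false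
≢⇒≡ᵇ-false {m} {n} m≢n with eqView m n
... | equal m≡n _ = ⊥-elim (m≢n m≡n)
... | distinct _ eq = eq

≡ᵇ-sym : ∀ m n → (m ≡ᵇ n) ≡ (n ≡ᵇ m)
≡ᵇ-sym m n with eqView m n
... | equal refl _ = refl
... | distinct m≢n eq = trans eq (sym (≢⇒≡ᵇ-false (λ n≡m → m≢n (sym n≡m))))

length-snoc : ∀ (σ : List ℕ) x → length (σ ++ x ∷ []) ≡ suc (length σ)
length-snoc σ x = trans (length-++ σ) (+-comm (length σ) 1)

-- Transpositions of values

swapVal-left : ∀ a b → swapVal a b a ≡ b
swapVal-left a b rewrite ≡ᵇ-refl a = refl

swapVal-right : ∀ a b → swapVal a b b ≡ a
swapVal-right a b with eqView b a
... | equal b≡a eq rewrite eq = b≡a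
... | distinct _ eq rewrite eq | ≡ᵇ-refl b = refl

swapVal-other : ∀ {a b x} → x ≢ a → x ≢ b → swapVal a b x ≡ x
swapVal-other x≢a x≢b rewrite ≢⇒≡ᵇ-false x≢a | ≢⇒≡ᵇ-false x≢b = refl

data SwapView (a b x : ℕ) : Set where
  isLeft  : x ≡ a → SwapView a b x
  isRight : x ≢ a → x ≡ b → SwapView a b x
  isOther : x ≢ a → x ≢ b → SwapView a b x

swapView : ∀ a b x → SwapView a b x
swapView a b x with eqView x a | eqView x b
... | equal x≡a _    | _             = isLeft x≡a
... | distinct x≢a _ | equal x≡b _    = isRight x≢a x≡b
... | distinct x≢a _ | distinct x≢b _ = isOther x≢a x≢b

swapVal-involutive : ∀ a b x → swapVal a b (swapVal a b x) ≡ x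
swapVal-involutive a b x with swapView a b x
... | isLeft refl     rewrite swapVal-left x b        = swapVal-right x b
... | isRight _ refl  rewrite swapVal-right a x       = swapVal-left a x
... | isOther x≢a x≢b rewrite swapVal-other x≢a x≢b = swapVal-other x≢a x≢b

swapVal-injective : ∀ a b {x y} → swapVal a b x ≡ swapVal a b y → x ≡ y
swapVal-injective a b {x} {y} eq =
  trans (sym (swapVal-involutive a b x)) (trans (cong (swapVal a b) eq) (swapVal-involutive a b y))

swapVal-≡ᵇ : ∀ a b x v → (swapVal a b x ≡ᵇ v) ≡ (x ≡ᵇ swapVal a b v)
swapVal-≡ᵇ a b x v with eqView x (swapVal a b v)
... | equal refl eq rewrite eq | swapVal-involutive a b v = ≡ᵇ-refl v
... | distinct x≢ eq rewrite eq =
  ≢⇒≡ᵇ-false {swapVal a b x} {v} (λ sx≡v → x≢ (trans (sym (swapVal-involutive a b x)) (cong (swapVal a b) sx≡v)))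

swapE-involutive : ∀ a b σ → swapE a b (swapE a b σ) ≡ σ
swapE-involutive a b []      = refl
swapE-involutive a b (x ∷ σ) = cong₂ _∷_ (swapVal-involutive a b x) (swapE-involutive a b σ)

swapE-injective : ∀ a b {σ τ} → swapE a b σ ≡ swapE a b τ → σ ≡ τ
swapE-injective a b {σ} {τ} eq =
  trans (sym (swapE-involutive a b σ)) (trans (cong (swapE a b) eq) (swapE-involutive a b τ))

swapE-snoc : ∀ a b σ x → swapE a b (σ ++ x ∷ []) ≡ swapE a b σ ++ swapVal a b x ∷ []
swapE-snoc a b σ x = map-++ (swapVal a b) σ (x ∷ [])

swapE-snoc-right : ∀ a b σ → swapE a b (σ ++ b ∷ []) ≡ swapE a b σ ++ a ∷ []
swapE-snoc-right a b σ = trans (swapE-snoc a b σ b) (cong (λ y → swapE a b σ ++ y ∷ []) (swapVal-right a b))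

swapE-snoc-left : ∀ a b σ → swapE a b (σ ++ a ∷ []) ≡ swapE a b σ ++ b ∷ []
swapE-snoc-left a b σ = trans (swapE-snoc a b σ a) (cong (λ y → swapE a b σ ++ y ∷ []) (swapVal-left a b))

swapE-snoc-other : ∀ a b σ {x} → x ≢ a → x ≢ b → swapE a b (σ ++ x ∷ []) ≡ swapE a b σ ++ x ∷ []
swapE-snoc-other a b σ x≢a x≢b = trans (swapE-snoc a b σ _) (cong (λ y → swapE a b σ ++ y ∷ []) (swapVal-other x≢a x≢b))

length-swapE : ∀ a b σ → length (swapE a b σ) ≡ length σ
length-swapE a b σ = length-map (swapVal a b) σ

length-swapE-snoc : ∀ {m} a b σ x → length σ ≡ m → length (swapE a b σ ++ x ∷ []) ≡ suc m
length-swapE-snoc a b σ x len = trans (length-snoc (swapE a b σ) x) (cong suc (trans (length-swapE a b σ) len))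

-- Occurrence counts and permutations of [m]

indicator : Bool → ℕ
indicator true  = 1
indicator false = 0

occ : ℕ → List ℕ → ℕ
occ v []       = 0
occ v (x ∷ xs) = indicator (x ≡ᵇ v) + occ v xs

occ-++ : ∀ v xs ys → occ v (xs ++ ys) ≡ occ v xs + occ v ys
occ-++ v []       ys = refl
occ-++ v (x ∷ xs) ys rewrite occ-++ v xs ys = sym (+-assoc (indicator (x ≡ᵇ v)) (occ v xs) (occ v ys))

occ-snoc : ∀ v xs x → occ v (xs ++ x ∷ []) ≡ occ v xs + indicator (x ≡ᵇ v)
occ-snoc v xs x = trans (occ-++ v xs (x ∷ [])) (cong (occ v xs +_) (+-identityʳ _))

occ-swapE : ∀ a b v σ → occ v (swapE a b σ) ≡ occ (swapVal a b v) σ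
occ-swapE a b v []      = refl
occ-swapE a b v (x ∷ σ) rewrite swapVal-≡ᵇ a b x v | occ-swapE a b v σ = refl

occ⇒split : ∀ x ys → 1 ≤ occ x ys → ∃ λ ys₁ → ∃ λ ys₂ → ys ≡ ys₁ ++ x ∷ ys₂
occ⇒split x (y ∷ ys) h with eqView y x
... | equal refl _ = [] , ys , refl
... | distinct _ eq rewrite eq with occ⇒split x ys h
...   | ys₁ , ys₂ , refl = y ∷ ys₁ , ys₂ , refl

↭⇒occ : ∀ {xs ys} v → xs ↭ ys → occ v xs ≡ occ v ys
↭⇒occ v ↭.refl        = refl
↭⇒occ v (↭.prep x p)  = cong (indicator (x ≡ᵇ v) +_) (↭⇒occ v p)
↭⇒occ {_} {_ ∷ _ ∷ ys} v (↭.swap x y p) rewrite ↭⇒occ v p = begin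
  indicator (x ≡ᵇ v) + (indicator (y ≡ᵇ v) + occ v ys) ≡⟨ x∙yz≈y∙xz (indicator (x ≡ᵇ v)) (indicator (y ≡ᵇ v)) (occ v ys) ⟩
  indicator (y ≡ᵇ v) + (indicator (x ≡ᵇ v) + occ v ys) ∎
↭⇒occ v (↭.trans p q) = trans (↭⇒occ v p) (↭⇒occ v q)

occ⇒↭ : ∀ xs ys → (∀ v → occ v xs ≡ occ v ys) → xs ↭ ys
occ⇒↭ []       []       h = ↭.refl
occ⇒↭ []       (y ∷ ys) h with trans (h y) (cong (λ b → indicator b + occ y ys) (≡ᵇ-refl y))
... | ()
occ⇒↭ (x ∷ xs) ys h with occ⇒split x ys (subst (1 ≤_) (h x) x∈x∷xs)
  where
  x∈x∷xs : 1 ≤ occ x (x ∷ xs)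
  x∈x∷xs rewrite ≡ᵇ-refl x = s≤s z≤n
... | ys₁ , ys₂ , refl = ↭.trans (↭.prep x (occ⇒↭ xs (ys₁ ++ ys₂) occ-rest)) (↭.↭-sym (shift x ys₁ ys₂))
  where
  occ-rest : ∀ v → occ v xs ≡ occ v (ys₁ ++ ys₂)
  occ-rest v = +-cancelˡ-≡ (indicator (x ≡ᵇ v)) _ _ (begin
    indicator (x ≡ᵇ v) + occ v xs                 ≡⟨ h v ⟩
    occ v (ys₁ ++ x ∷ ys₂)                         ≡⟨ occ-++ v ys₁ (x ∷ ys₂) ⟩
    occ v ys₁ + (indicator (x ≡ᵇ v) + occ v ys₂)   ≡⟨ x∙yz≈y∙xz (occ v ys₁) (indicator (x ≡ᵇ v)) (occ v ys₂) ⟩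
    indicator (x ≡ᵇ v) + (occ v ys₁ + occ v ys₂)   ≡⟨ cong (indicator (x ≡ᵇ v) +_) (sym (occ-++ v ys₁ ys₂)) ⟩
    indicator (x ≡ᵇ v) + occ v (ys₁ ++ ys₂)        ∎)

range : ℕ → List ℕ
range m = map suc (upTo m)

range-suc : ∀ m → range (suc m) ≡ range m ++ suc m ∷ []
range-suc m = trans (cong (map suc) (sym (upTo-∷ʳ m))) (map-++ suc (upTo m) (m ∷ []))

length-range : ∀ m → length (range m) ≡ m
length-range m = trans (length-map suc (upTo m)) (length-upTo m)

occ-range-suc : ∀ m v → occ v (range (suc m)) ≡ occ v (range m) + indicator (suc m ≡ᵇ v)
occ-range-suc m v = trans (cong (occ v) (range-suc m)) (occ-snoc v (range m) (suc m))

occ-range-outside : ∀ m v → m < v → occ v (range m) ≡ 0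
occ-range-outside zero    v m<v = refl
occ-range-outside (suc m) v m<v
  rewrite occ-range-suc m v | occ-range-outside m v (<-trans (n<1+n m) m<v) | ≢⇒≡ᵇ-false (<⇒≢ m<v) = refl

occ-range-inside : ∀ m v → 1 ≤ v → v ≤ m → occ v (range m) ≡ 1
occ-range-inside zero    (suc v) _   ()
occ-range-inside (suc m) v 1≤v v≤1+m rewrite occ-range-suc m v with m≤n⇒m<n∨m≡n v≤1+m
... | inj₁ (s≤s v≤m) rewrite occ-range-inside m v 1≤v v≤m | ≢⇒≡ᵇ-false (λ e → <⇒≢ (s≤s v≤m) (sym e)) = refl
... | inj₂ refl rewrite occ-range-outside m (suc m) (n<1+n m) | ≡ᵇ-refl m = refl

occ-range-zero : ∀ m → occ 0 (range m) ≡ 0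
occ-range-zero zero    = refl
occ-range-zero (suc m) rewrite occ-range-suc m 0 | occ-range-zero m = refl

occurs-in-range : ∀ m v → 1 ≤ occ v (range m) → 1 ≤ v × v ≤ m
occurs-in-range m zero h rewrite occ-range-zero m with h
... | ()
occurs-in-range m (suc v) h with ltView m (suc v)
... | less m<v _ rewrite occ-range-outside m (suc v) m<v with h
...   | ()
occurs-in-range m (suc v) h | notLess v≤m _ = s≤s z≤n , v≤m

CountPerm : ℕ → List ℕ → Set
CountPerm m σ = ∀ v → occ v σ ≡ occ v (range m)

CountPerm-snoc : ∀ m σ → CountPerm m σ → CountPerm (suc m) (σ ++ suc m ∷ [])
CountPerm-snoc m σ p v = begin
  occ v (σ ++ suc m ∷ [])                     ≡⟨ occ-snoc v σ (suc m) ⟩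
  occ v σ + indicator (suc m ≡ᵇ v)           ≡⟨ cong (_+ indicator (suc m ≡ᵇ v)) (p v) ⟩
  occ v (range m) + indicator (suc m ≡ᵇ v)   ≡⟨ occ-range-suc m v ⟨
  occ v (range (suc m))                       ∎

CountPerm-unsnoc : ∀ m σ → CountPerm (suc m) (σ ++ suc m ∷ []) → CountPerm m σ
CountPerm-unsnoc m σ p v = +-cancelʳ-≡ (indicator (suc m ≡ᵇ v)) _ _ (begin
  occ v σ + indicator (suc m ≡ᵇ v)           ≡⟨ occ-snoc v σ (suc m) ⟨
  occ v (σ ++ suc m ∷ [])                     ≡⟨ p v ⟩
  occ v (range (suc m))                       ≡⟨ occ-range-suc m v ⟩
  occ v (range m) + indicator (suc m ≡ᵇ v)   ∎)

occ-range-swapVal : ∀ m a b v → 1 ≤ a → a ≤ m → 1 ≤ b → b ≤ m →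
                    occ (swapVal a b v) (range m) ≡ occ v (range m)
occ-range-swapVal m a b v 1≤a a≤m 1≤b b≤m with swapView a b v
... | isLeft refl rewrite swapVal-left v b | occ-range-inside m b 1≤b b≤m | occ-range-inside m v 1≤a a≤m = refl
... | isRight _ refl rewrite swapVal-right a v | occ-range-inside m a 1≤a a≤m | occ-range-inside m v 1≤b b≤m = refl
... | isOther v≢a v≢b rewrite swapVal-other v≢a v≢b = refl

CountPerm-swapE : ∀ m a b σ → 1 ≤ a → a ≤ m → 1 ≤ b → b ≤ m → CountPerm m σ → CountPerm m (swapE a b σ)
CountPerm-swapE m a b σ 1≤a a≤m 1≤b b≤m p v = begin
  occ v (swapE a b σ)             ≡⟨ occ-swapE a b v σ ⟩
  occ (swapVal a b v) σ           ≡⟨ p (swapVal a b v) ⟩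
  occ (swapVal a b v) (range m)   ≡⟨ occ-range-swapVal m a b v 1≤a a≤m 1≤b b≤m ⟩
  occ v (range m)                 ∎

-- Positions and fixed points

-- At i σ j v: numbering the positions of σ from i, position j holds v.
data At : ℕ → List ℕ → ℕ → ℕ → Set where
  here  : ∀ {i x xs} → At i (x ∷ xs) i x
  there : ∀ {i y xs j v} → At (suc i) xs j v → At i (y ∷ xs) j v

At-bounds : ∀ {i σ j v} → At i σ j v → i ≤ j × j < i + length σ
At-bounds {i} {x ∷ xs} here = ≤-refl , subst (i <_) (sym (+-suc i (length xs))) (s≤s (m≤m+n i _))
At-bounds {i} {y ∷ xs} {j} (there a) with At-bounds a
... | i<j , j<end = <⇒≤ i<j , subst (j <_) (sym (+-suc i (length xs))) j<end

At-functional : ∀ {i σ j v v′} → At i σ j v → At i σ j v′ → v ≡ v′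
At-functional here      here      = refl
At-functional here      (there a) = ⊥-elim (n≮n _ (proj₁ (At-bounds a)))
At-functional (there a) here      = ⊥-elim (n≮n _ (proj₁ (At-bounds a)))
At-functional (there a) (there b) = At-functional a b

At⇒occ : ∀ {i σ j v} → At i σ j v → 1 ≤ occ v σ
At⇒occ {σ = x ∷ xs} here rewrite ≡ᵇ-refl x = s≤s z≤n
At⇒occ {σ = y ∷ xs} {v = v} (there a) = ≤-trans (At⇒occ a) (m≤n+m (occ v xs) _)

occ⇒At : ∀ i v σ → 1 ≤ occ v σ → ∃ λ j → At i σ j v
occ⇒At i v (x ∷ σ) h with eqView x v
... | equal refl _ = i , here
... | distinct _ eq rewrite eq with occ⇒At (suc i) v σ h
...   | j , a = j , there a

At-unique : ∀ {i σ j j′ v} → occ v σ ≡ 1 → At i σ j v → At i σ j′ v → j ≡ j′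
At-unique _ here here = refl
At-unique {σ = x ∷ xs} once here (there b) rewrite ≡ᵇ-refl x = ⊥-elim (<-irrefl (sym once) (s≤s (At⇒occ b)))
At-unique {σ = x ∷ xs} once (there a) here rewrite ≡ᵇ-refl x = ⊥-elim (<-irrefl (sym once) (s≤s (At⇒occ a)))
At-unique {σ = y ∷ xs} {v = v} once (there a) (there b) =
  At-unique (≤-antisym (≤-trans (m≤n+m (occ v xs) _) (≤-reflexive once)) (At⇒occ a)) a b

At-map : ∀ (f : ℕ → ℕ) {i σ j v} → At i σ j v → At i (map f σ) j (f v)
At-map f here      = here
At-map f (there a) = there (At-map f a)

At-map⁻ : ∀ (f : ℕ → ℕ) {i σ j v} → At i (map f σ) j v → ∃ λ u → At i σ j u × f u ≡ v
At-map⁻ f {σ = x ∷ σ} here = x , here , refl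
At-map⁻ f {σ = x ∷ σ} (there a) with At-map⁻ f a
... | u , b , fu≡v = u , there b , fu≡v

At-++ˡ : ∀ {i σ j v} τ → At i σ j v → At i (σ ++ τ) j v
At-++ˡ τ here      = here
At-++ˡ τ (there a) = there (At-++ˡ τ a)

At-++ʳ : ∀ {i j v} σ {τ} → At (i + length σ) τ j v → At i (σ ++ τ) j v
At-++ʳ {i} []      a rewrite +-identityʳ i = a
At-++ʳ {i} (x ∷ σ) a rewrite +-suc i (length σ) = there (At-++ʳ σ a)

At-++⁻ : ∀ {i j v} σ {τ} → At i (σ ++ τ) j v → At i σ j v ⊎ At (i + length σ) τ j v
At-++⁻ {i} []      a rewrite +-identityʳ i = inj₂ a
At-++⁻     (x ∷ σ) here = inj₁ here
At-++⁻ {i} (x ∷ σ) (there a) rewrite +-suc i (length σ) with At-++⁻ σ a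
... | inj₁ b = inj₁ (there b)
... | inj₂ b = inj₂ b

At-last : ∀ {m} σ x → length σ ≡ m → At 1 (σ ++ x ∷ []) (suc m) x
At-last σ x refl = At-++ʳ σ here

At-snoc⁻ : ∀ {m j v} σ x → length σ ≡ m → At 1 (σ ++ x ∷ []) j v → j ≢ suc m → At 1 σ j v
At-snoc⁻ σ x refl a j≢last with At-++⁻ σ a
... | inj₁ b         = b
... | inj₂ here      = ⊥-elim (j≢last refl)
... | inj₂ (there ())

At-lookup : ∀ k σ (i : Fin (length σ)) → At k σ (k + toℕ i) (lookup σ i)
At-lookup k (x ∷ σ) fzero    rewrite +-identityʳ k = here
At-lookup k (x ∷ σ) (fsuc i) rewrite +-suc k (toℕ i) = there (At-lookup (suc k) σ i)

At⇒lookup : ∀ {k σ j v} → At k σ j v → ∃ λ (i : Fin (length σ)) → (k + toℕ i ≡ j) × lookup σ i ≡ v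
At⇒lookup {k} here = fzero , +-identityʳ k , refl
At⇒lookup {k} (there a) with At⇒lookup a
... | i , k+i≡j , eq = fsuc i , trans (+-suc k (toℕ i)) k+i≡j , eq

CountPerm-entry : ∀ {m σ i j v} → CountPerm m σ → At i σ j v → 1 ≤ v × v ≤ m
CountPerm-entry {m} {σ} {v = v} p a = occurs-in-range m v (subst (1 ≤_) (p v) (At⇒occ a))

CountPerm-position-unique : ∀ {m σ i j j′ v} → CountPerm m σ → At i σ j v → At i σ j′ v → j ≡ j′
CountPerm-position-unique {m} {v = v} p a b with CountPerm-entry p a
... | 1≤v , v≤m = At-unique (trans (p v) (occ-range-inside m v 1≤v v≤m)) a b

FixedPoint : List ℕ → ℕ → Set
FixedPoint σ j = At 1 σ j j

HasFixedPoint : List ℕ → Set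
HasFixedPoint σ = ∃ (FixedPoint σ)

OnlyFixedPoint : ℕ → List ℕ → Set
OnlyFixedPoint w σ = ∀ {j} → FixedPoint σ j → j ≡ w

HasFix⇒HasFixedPoint : ∀ σ → HasFix σ → HasFixedPoint σ
HasFix⇒HasFixedPoint σ (i , eq) = suc (toℕ i) , subst (At 1 σ (suc (toℕ i))) eq (At-lookup 1 σ i)

HasFixedPoint⇒HasFix : ∀ σ → HasFixedPoint σ → HasFix σ
HasFixedPoint⇒HasFix σ (j , a) with At⇒lookup a
... | i , refl , eq = i , eq

swapE-FixedPoint : ∀ {a b σ j} → FixedPoint σ j → j ≢ a → j ≢ b → FixedPoint (swapE a b σ) j
swapE-FixedPoint {a} {b} {σ} {j} fix j≢a j≢b =
  subst (At 1 (swapE a b σ) j) (swapVal-other j≢a j≢b) (At-map (swapVal a b) fix)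

hasFixOtherFrom-true⇒ : ∀ x i σ → hasFixOtherFrom x i σ ≡ true → ∃ λ j → At i σ j j × j ≢ x
hasFixOtherFrom-true⇒ x i (y ∷ σ) h with eqView y i | eqView i x
... | equal refl eq | distinct i≢x eq′ rewrite eq | eq′ = y , here , i≢x
... | equal refl eq | equal _ eq′ rewrite eq | eq′ with hasFixOtherFrom-true⇒ x (suc i) σ h
...   | j , a , j≢x = j , there a , j≢x
hasFixOtherFrom-true⇒ x i (y ∷ σ) h | distinct _ eq | _ rewrite eq with hasFixOtherFrom-true⇒ x (suc i) σ h
...   | j , a , j≢x = j , there a , j≢x

hasFixOtherFrom-intro : ∀ x {i σ j} → At i σ j j → j ≢ x → hasFixOtherFrom x i σ ≡ true
hasFixOtherFrom-intro x {σ = y ∷ σ} here      j≢x rewrite ≡ᵇ-refl y | ≢⇒≡ᵇ-false j≢x = refl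
hasFixOtherFrom-intro x {σ = y ∷ σ} (there a) j≢x rewrite hasFixOtherFrom-intro x a j≢x = ∨-zeroʳ _

hasFixOther-false⇒OnlyFixedPoint : ∀ x σ → hasFixOther x σ ≡ false → OnlyFixedPoint x σ
hasFixOther-false⇒OnlyFixedPoint x σ h {j} fix with eqView j x
... | equal j≡x _ = j≡x
... | distinct j≢x _ with trans (sym h) (hasFixOtherFrom-intro x fix j≢x)
...   | ()

-- D̄_m, with the permutation condition expressed by occurrence counts.
FixPerm : ℕ → List ℕ → Set
FixPerm m σ = (length σ ≡ m) × CountPerm m σ × HasFixedPoint σ

Dbar⇒FixPerm : ∀ m σ → Dbar m σ → FixPerm m σ
Dbar⇒FixPerm m σ (σ↭ , fix) =
  trans (↭-length σ↭) (length-range m) , (λ v → ↭⇒occ v σ↭) , HasFix⇒HasFixedPoint σ fix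

FixPerm⇒Dbar : ∀ m σ → FixPerm m σ → Dbar m σ
FixPerm⇒Dbar m σ (_ , p , fix) = occ⇒↭ σ (range m) p , HasFixedPoint⇒HasFix σ fix

OnlyFixedPoint⇒FixedPoint : ∀ {m w σ} → FixPerm m σ → OnlyFixedPoint w σ → FixedPoint σ w
OnlyFixedPoint⇒FixedPoint (_ , _ , j , fix) only with only fix
... | refl = fix

OnlyFixedPoint⇒hasFixOther-false : ∀ x σ → OnlyFixedPoint x σ → hasFixOther x σ ≡ false
OnlyFixedPoint⇒hasFixOther-false x σ only with hasFixOther x σ in h
... | false = refl
... | true with hasFixOtherFrom-true⇒ x 1 σ h
...   | j , fix , j≢x = ⊥-elim (j≢x (only fix))

-- One step of φ

pad-one : ∀ σ → pad (suc (length σ)) σ ≡ σ ++ suc (length σ) ∷ []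
pad-one σ rewrite m+n∸n≡m 1 (length σ) | +-comm (length σ) 1 = refl

pad-two : ∀ σ → pad (suc (suc (length σ))) σ ≡ (σ ++ suc (length σ) ∷ []) ++ suc (suc (length σ)) ∷ []
pad-two σ rewrite m+n∸n≡m 2 (length σ) | +-comm (length σ) 1 | +-comm (length σ) 2 =
  sym (++-assoc σ (suc (length σ) ∷ []) (suc (suc (length σ)) ∷ []))

-- Admissible m (b , σ): σ = σ_m lies in D̄_{m-1} when w_m = R (b = true) and in D̄_m otherwise.
Admissible : ℕ → Bool × List ℕ → Set
Admissible m (true  , σ) = FixPerm (m ∸ 1) σ
Admissible m (false , σ) = FixPerm m σ

grow : ℕ → ℕ × Bool × List ℕ → List ℕ
grow m (w , b , σ) = step (suc m) (if b then R else val 0) (val w) σ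

GrowDom : ℕ → ℕ × Bool × List ℕ → Set
GrowDom m (w , s) = (1 ≤ w) × (w ≤ m) × Admissible m s

grow-fixElsewhere : ∀ {m} w σ → length σ ≡ m → hasFixOther w σ ≡ true →
                    grow m (w , false , σ) ≡ swapE w (suc m) σ ++ w ∷ []
grow-fixElsewhere {m} w σ refl h = begin
  grow m (w , false , σ)                   ≡⟨ cong (λ c → if c then swapE w (suc m) (pad (suc m) σ)
                                                              else swapE w m (pad (suc m) σ)) h ⟩
  swapE w (suc m) (pad (suc m) σ)          ≡⟨ cong (swapE w (suc m)) (pad-one σ) ⟩
  swapE w (suc m) (σ ++ suc m ∷ [])        ≡⟨ swapE-snoc-right w (suc m) σ ⟩
  swapE w (suc m) σ ++ w ∷ []              ∎

grow-fixOnlyAt : ∀ {m} w σ → length σ ≡ m → w ≤ m → hasFixOther w σ ≡ false →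
                 grow m (w , false , σ) ≡ swapE w m σ ++ suc m ∷ []
grow-fixOnlyAt {m} w σ refl w≤m h = begin
  grow m (w , false , σ)                   ≡⟨ cong (λ c → if c then swapE w (suc m) (pad (suc m) σ)
                                                              else swapE w m (pad (suc m) σ)) h ⟩
  swapE w m (pad (suc m) σ)                ≡⟨ cong (swapE w m) (pad-one σ) ⟩
  swapE w m (σ ++ suc m ∷ [])              ≡⟨ swapE-snoc-other w m σ (>⇒≢ (s≤s w≤m)) 1+n≢n ⟩
  swapE w m σ ++ suc m ∷ []                ∎

grow-afterRepeat : ∀ {m₀} w σ → length σ ≡ m₀ → w ≤ suc m₀ →
                   grow (suc m₀) (w , true , σ) ≡ (swapE w (suc m₀) σ ++ w ∷ []) ++ suc (suc m₀) ∷ []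
grow-afterRepeat {m₀} w σ refl w≤m = begin
  swapE w m (pad (suc m) σ)                          ≡⟨ cong (swapE w m) (pad-two σ) ⟩
  swapE w m ((σ ++ m ∷ []) ++ suc m ∷ [])            ≡⟨ swapE-snoc-other w m (σ ++ m ∷ []) (>⇒≢ (s≤s w≤m)) 1+n≢n ⟩
  swapE w m (σ ++ m ∷ []) ++ suc m ∷ []              ≡⟨ cong (_++ suc m ∷ []) (swapE-snoc-right w m σ) ⟩
  (swapE w m σ ++ w ∷ []) ++ suc m ∷ []              ∎
  where m = suc m₀

HasOtherFixedPoint : ℕ → List ℕ → Set
HasOtherFixedPoint w σ = ∃ λ j → FixedPoint σ j × j ≢ w

-- The three branches of the definition of σ_{m+1}, each with its result in normal form.
data GrowCase (m w : ℕ) : Bool × List ℕ → List ℕ → Set where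
  fixElsewhere : ∀ {σ} → HasOtherFixedPoint w σ → GrowCase m w (false , σ) (swapE w (suc m) σ ++ w ∷ [])
  fixOnlyAt    : ∀ {σ} → OnlyFixedPoint w σ     → GrowCase m w (false , σ) (swapE w m σ ++ suc m ∷ [])
  afterRepeat  : ∀ {σ} → GrowCase m w (true , σ) ((swapE w m σ ++ w ∷ []) ++ suc m ∷ [])

growCase : ∀ m w s → 1 ≤ m → w ≤ m → Admissible m s → GrowCase m w s (grow m (w , s))
growCase m w (false , σ) _ w≤m (len , _) = byFixTest (hasFixOther w σ) refl
  where
  byFixTest : ∀ b → hasFixOther w σ ≡ b → GrowCase m w (false , σ) (grow m (w , false , σ))
  byFixTest true  h = subst (GrowCase m w (false , σ)) (sym (grow-fixElsewhere w σ len h))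
                            (fixElsewhere (hasFixOtherFrom-true⇒ w 1 σ h))
  byFixTest false h = subst (GrowCase m w (false , σ)) (sym (grow-fixOnlyAt w σ len w≤m h))
                            (fixOnlyAt (hasFixOther-false⇒OnlyFixedPoint w σ h))
growCase (suc m₀) w (true , σ) _ w≤m (len , _) =
  subst (GrowCase (suc m₀) w (true , σ)) (sym (grow-afterRepeat w σ len w≤m)) afterRepeat

CountPerm-swap-last : ∀ m σ w → 1 ≤ w → w ≤ suc m → CountPerm m σ →
                      CountPerm (suc m) (swapE w (suc m) σ ++ w ∷ [])
CountPerm-swap-last m σ w 1≤w w≤ p =
  subst (CountPerm (suc m)) (swapE-snoc-right w (suc m) σ)
        (CountPerm-swapE (suc m) w (suc m) (σ ++ suc m ∷ []) 1≤w w≤ (s≤s z≤n) ≤-refl (CountPerm-snoc m σ p))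

FixPerm-snoc-top : ∀ m τ → length τ ≡ m → CountPerm m τ → FixPerm (suc m) (τ ++ suc m ∷ [])
FixPerm-snoc-top m τ len p = trans (length-snoc τ (suc m)) (cong suc len) , CountPerm-snoc m τ p , suc m , At-last τ (suc m) len

GrowCase-FixPerm : ∀ {m w s τ} → 1 ≤ m → 1 ≤ w → w ≤ m → Admissible m s → GrowCase m w s τ → FixPerm (suc m) τ
GrowCase-FixPerm {m} {w} {false , σ} 1≤m 1≤w w≤m (len , p , _) (fixElsewhere (j , fix , j≢w)) =
  length-swapE-snoc w (suc m) σ w len ,
  CountPerm-swap-last m σ w 1≤w (m≤n⇒m≤1+n w≤m) p ,
  j , At-++ˡ (w ∷ []) (swapE-FixedPoint fix j≢w (<⇒≢ j<1+m))
  where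
  j<1+m : j < suc m
  j<1+m = subst (j <_) (cong suc len) (proj₂ (At-bounds fix))
GrowCase-FixPerm {m} {w} {false , σ} 1≤m 1≤w w≤m (len , p , _) (fixOnlyAt _) =
  FixPerm-snoc-top m (swapE w m σ) (trans (length-swapE w m σ) len) (CountPerm-swapE m w m σ 1≤w w≤m 1≤m ≤-refl p)
GrowCase-FixPerm {suc m₀} {w} {true , σ} _ 1≤w w≤m (len , p , _) afterRepeat =
  FixPerm-snoc-top (suc m₀) (swapE w (suc m₀) σ ++ w ∷ []) (length-swapE-snoc w (suc m₀) σ w len)
                   (CountPerm-swap-last m₀ σ w 1≤w w≤m p)

grow-into : ∀ m x → 1 ≤ m → GrowDom m x → FixPerm (suc m) (grow m x)
grow-into m (w , s) 1≤m (1≤w , w≤m , adm) = GrowCase-FixPerm 1≤m 1≤w w≤m adm (growCase m w s 1≤m w≤m adm)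

-- The positions where τ agrees with the transposition (a m) are the fixed points of swapE a m τ.
agreement-clash : ∀ {m w w′ j τ} → CountPerm m τ → (∀ {i} → At 1 τ i (swapVal w m i) → i ≡ w) →
                  At 1 τ w m → At 1 τ m w′ → At 1 τ j (swapVal w′ m j) → j ≢ m → ⊥
agreement-clash {m} {w} {w′} {j} {τ} p only atW atM atJ j≢m with eqView j w | eqView j w′
... | equal refl _ | _ = j≢m (sym (only (subst (At 1 τ m) (trans (sym w≡w′) (sym (swapVal-right w m))) atM)))
  where
  w≡w′ : w ≡ w′
  w≡w′ = swapVal-injective w′ m (trans (At-functional atJ atW) (sym (swapVal-left w′ m)))
... | distinct j≢w _ | equal refl _ =
  j≢w (CountPerm-position-unique {m} p (subst (At 1 τ j) (swapVal-left j m) atJ) atW)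
... | distinct j≢w _ | distinct j≢w′ _ =
  j≢w (only (subst (At 1 τ j) (trans (swapVal-other j≢w′ j≢m) (sym (swapVal-other j≢w j≢m))) atJ))

swapE-moves-fixed : ∀ {w σ} m → FixedPoint σ w → At 1 (swapE w m σ) w m
swapE-moves-fixed {w} {σ} m fix = subst (At 1 (swapE w m σ) w) (swapVal-left w m) (At-map (swapVal w m) fix)

CountPerm-swapE-fixed : ∀ {m w σ} → CountPerm m σ → FixedPoint σ w → CountPerm m (swapE w m σ)
CountPerm-swapE-fixed {m} {w} {σ} p fix with CountPerm-entry p fix
... | 1≤w , w≤m = CountPerm-swapE m w m σ 1≤w w≤m (≤-trans 1≤w w≤m) ≤-refl p

fixOnlyAt≢afterRepeat : ∀ m₀ w w′ σ σ′ → FixPerm (suc m₀) σ → OnlyFixedPoint w σ → FixPerm m₀ σ′ →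
                        swapE w (suc m₀) σ ≢ swapE w′ (suc m₀) σ′ ++ w′ ∷ []
fixOnlyAt≢afterRepeat m₀ w w′ σ σ′ fσ@(_ , p , _) only (len′ , _ , j , fixJ) eq =
  agreement-clash (CountPerm-swapE-fixed p fixW) onlyτ (swapE-moves-fixed m fixW) atM atJ j≢m
  where
  m = suc m₀
  fixW : FixedPoint σ w
  fixW = OnlyFixedPoint⇒FixedPoint fσ only
  onlyτ : ∀ {i} → At 1 (swapE w m σ) i (swapVal w m i) → i ≡ w
  onlyτ {i} a with At-map⁻ (swapVal w m) a
  ... | u , b , eqᵤ = only (subst (At 1 σ i) (swapVal-injective w m eqᵤ) b)
  atM : At 1 (swapE w m σ) m w′
  atM = subst (λ τ → At 1 τ m w′) (sym eq) (At-last (swapE w′ m σ′) w′ (trans (length-swapE w′ m σ′) len′))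
  atJ : At 1 (swapE w m σ) j (swapVal w′ m j)
  atJ = subst (λ τ → At 1 τ j (swapVal w′ m j)) (sym eq) (At-++ˡ (w′ ∷ []) (At-map (swapVal w′ m) fixJ))
  j≢m : j ≢ m
  j≢m = <⇒≢ (subst (j <_) (cong suc len′) (proj₂ (At-bounds fixJ)))

fixOnlyAt-injective : ∀ {m w w′ σ σ′} → FixPerm m σ → OnlyFixedPoint w σ → FixPerm m σ′ → OnlyFixedPoint w′ σ′ →
                      swapE w m σ ≡ swapE w′ m σ′ → w ≡ w′
fixOnlyAt-injective {m} {w} {w′} {σ} fσ@(_ , p , _) only fσ′ only′ eq =
  CountPerm-position-unique {m} (CountPerm-swapE-fixed p fixW) (swapE-moves-fixed m fixW)
    (subst (λ τ → At 1 τ w′ m) (sym eq) (swapE-moves-fixed m (OnlyFixedPoint⇒FixedPoint fσ′ only′)))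
  where
  fixW : FixedPoint σ w
  fixW = OnlyFixedPoint⇒FixedPoint fσ only

GrowCase-injective : ∀ {m w w′ s s′ τ τ′} → 1 ≤ m → w ≤ m → w′ ≤ m → Admissible m s → Admissible m s′ →
                     GrowCase m w s τ → GrowCase m w′ s′ τ′ → τ ≡ τ′ → (w , s) ≡ (w′ , s′)
GrowCase-injective {m} {w} {s = false , σ} _ _ _ _ _ (fixElsewhere _) (fixElsewhere _) eq
  with ∷ʳ-injective (swapE w (suc m) σ) _ eq
... | init≡ , refl = cong (λ σ → w , false , σ) (swapE-injective w (suc m) init≡)
GrowCase-injective _ w≤m _ _ _ (fixElsewhere _) (fixOnlyAt _) eq = ⊥-elim (<⇒≢ (s≤s w≤m) (∷ʳ-injectiveʳ _ _ eq))
GrowCase-injective _ w≤m _ _ _ (fixElsewhere _) afterRepeat eq = ⊥-elim (<⇒≢ (s≤s w≤m) (∷ʳ-injectiveʳ _ _ eq))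
GrowCase-injective _ _ w′≤m _ _ (fixOnlyAt _) (fixElsewhere _) eq = ⊥-elim (<⇒≢ (s≤s w′≤m) (sym (∷ʳ-injectiveʳ _ _ eq)))
GrowCase-injective _ _ w′≤m _ _ afterRepeat (fixElsewhere _) eq = ⊥-elim (<⇒≢ (s≤s w′≤m) (sym (∷ʳ-injectiveʳ _ _ eq)))
GrowCase-injective {m} {w} {w′} {false , σ} {false , σ′} _ _ _ fσ fσ′ (fixOnlyAt only) (fixOnlyAt only′) eq
  with ∷ʳ-injectiveˡ (swapE w m σ) (swapE w′ m σ′) eq
... | init≡ with fixOnlyAt-injective fσ only fσ′ only′ init≡
...   | refl = cong (λ σ → w , false , σ) (swapE-injective w m init≡)
GrowCase-injective {suc m₀} {w} {w′} {false , σ} {true , σ′} _ _ _ fσ fσ′ (fixOnlyAt only) afterRepeat eq =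
  ⊥-elim (fixOnlyAt≢afterRepeat m₀ w w′ σ σ′ fσ only fσ′ (∷ʳ-injectiveˡ _ _ eq))
GrowCase-injective {suc m₀} {w} {w′} {true , σ} {false , σ′} _ _ _ fσ fσ′ afterRepeat (fixOnlyAt only′) eq =
  ⊥-elim (fixOnlyAt≢afterRepeat m₀ w′ w σ′ σ fσ′ only′ fσ (sym (∷ʳ-injectiveˡ _ _ eq)))
GrowCase-injective {m} {w} {s = true , σ} _ _ _ _ _ afterRepeat afterRepeat eq
  with ∷ʳ-injective (swapE w m σ) _ (∷ʳ-injectiveˡ _ _ eq)
... | init≡ , refl = cong (λ σ → w , true , σ) (swapE-injective w m init≡)

-- Positions start at 1, so hasFixOther 0 tests for any fixed point.
fixedPoint? : ∀ σ → Dec (HasFixedPoint σ)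
fixedPoint? σ with hasFixOther 0 σ in h
... | true  = yes (proj₁ (hasFixOtherFrom-true⇒ 0 1 σ h) , proj₁ (proj₂ (hasFixOtherFrom-true⇒ 0 1 σ h)))
... | false = no λ (j , fix) → n≮0 (subst (1 ≤_) (hasFixOther-false⇒OnlyFixedPoint 0 σ h fix) (proj₁ (At-bounds fix)))

CountPerm-unswap-last : ∀ m ρ v → 1 ≤ v → v ≤ suc m → CountPerm (suc m) (ρ ++ v ∷ []) →
                        CountPerm m (swapE v (suc m) ρ)
CountPerm-unswap-last m ρ v 1≤v v≤ p =
  CountPerm-unsnoc m (swapE v (suc m) ρ)
    (subst (CountPerm (suc m)) (swapE-snoc-left v (suc m) ρ)
           (CountPerm-swapE (suc m) v (suc m) (ρ ++ v ∷ []) 1≤v v≤ (s≤s z≤n) ≤-refl p))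

GrowPreimage : ℕ → List ℕ → Set
GrowPreimage m τ = ∃ λ x → GrowDom m x × grow m x ≡ τ

preimage-fixElsewhere : ∀ m ρ v → FixPerm (suc m) (ρ ++ v ∷ []) → v ≢ suc m → GrowPreimage m (ρ ++ v ∷ [])
preimage-fixElsewhere m ρ v (len , p , j , fixJ) v≢top =
  (v , false , σ) , (1≤v , v≤m , lenσ , CountPerm-unswap-last m ρ v 1≤v (m≤n⇒m≤1+n v≤m) p , j , fixσ) , grow≡
  where
  lenρ : length ρ ≡ m
  lenρ = suc-injective (trans (sym (length-snoc ρ v)) len)
  atTop : At 1 (ρ ++ v ∷ []) (suc m) v
  atTop = At-last ρ v lenρ
  1≤v : 1 ≤ v
  1≤v = proj₁ (CountPerm-entry {suc m} p atTop)
  v≤m : v ≤ m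
  v≤m = m<1+n⇒m≤n (≤∧≢⇒< (proj₂ (CountPerm-entry {suc m} p atTop)) v≢top)
  σ = swapE v (suc m) ρ
  lenσ : length σ ≡ m
  lenσ = trans (length-swapE v (suc m) ρ) lenρ
  j≢top : j ≢ suc m
  j≢top refl = v≢top (At-functional atTop fixJ)
  j≢v : j ≢ v
  j≢v refl = j≢top (CountPerm-position-unique {suc m} p fixJ atTop)
  fixσ : FixedPoint σ j
  fixσ = swapE-FixedPoint (At-snoc⁻ ρ v lenρ fixJ j≢top) j≢v j≢top
  grow≡ : grow m (v , false , σ) ≡ ρ ++ v ∷ []
  grow≡ = trans (grow-fixElsewhere v σ lenσ (hasFixOtherFrom-intro v fixσ j≢v))
                (cong (_++ v ∷ []) (swapE-involutive v (suc m) ρ))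

preimage-afterRepeat : ∀ m₀ π u → length π ≡ m₀ → CountPerm (suc m₀) (π ++ u ∷ []) →
                       HasFixedPoint (swapE u (suc m₀) π) → GrowPreimage (suc m₀) ((π ++ u ∷ []) ++ suc (suc m₀) ∷ [])
preimage-afterRepeat m₀ π u lenπ p fix =
  (u , true , σ) , (1≤u , u≤m , lenσ , CountPerm-unswap-last m₀ π u 1≤u u≤m p , fix) , grow≡
  where
  m = suc m₀
  σ = swapE u m π
  atU : At 1 (π ++ u ∷ []) m u
  atU = At-last π u lenπ
  1≤u : 1 ≤ u
  1≤u = proj₁ (CountPerm-entry {m} p atU)
  u≤m : u ≤ m
  u≤m = proj₂ (CountPerm-entry {m} p atU)
  lenσ : length σ ≡ m₀
  lenσ = trans (length-swapE u m π) lenπ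
  grow≡ : grow m (u , true , σ) ≡ (π ++ u ∷ []) ++ suc m ∷ []
  grow≡ = trans (grow-afterRepeat u σ lenσ u≤m)
                (cong (λ π′ → (π′ ++ u ∷ []) ++ suc m ∷ []) (swapE-involutive u m π))

second-fixed-point⇒HasFixedPoint : ∀ m₀ π u q j → length π ≡ m₀ → CountPerm (suc m₀) (π ++ u ∷ []) →
  At 1 (π ++ u ∷ []) q (suc m₀) → FixedPoint (swapE q (suc m₀) (π ++ u ∷ [])) j → j ≢ q →
  HasFixedPoint (swapE u (suc m₀) π)
second-fixed-point⇒HasFixedPoint m₀ π u q j lenπ p atQ fix j≢q with At-map⁻ (swapVal q (suc m₀)) fix
... | y , atY , y↦j with swapView q (suc m₀) y
...   | isLeft refl = q , subst (At 1 (swapE u m π) q) (trans (swapVal-right u m) u≡q) (At-map (swapVal u m) atπQ)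
  where
  m = suc m₀
  j≡m : j ≡ m
  j≡m = trans (sym y↦j) (swapVal-left q m)
  u≡q : u ≡ q
  u≡q = At-functional (At-last π u lenπ) (subst (λ k → At 1 (π ++ u ∷ []) k q) j≡m atY)
  atπQ : At 1 π q m
  atπQ = At-snoc⁻ π u lenπ atQ (λ q≡m → j≢q (trans j≡m (sym q≡m)))
...   | isRight _ refl = ⊥-elim (j≢q (trans (sym y↦j) (swapVal-right q y)))
...   | isOther y≢q y≢m = j , swapE-FixedPoint (At-snoc⁻ π u lenπ fixρ j≢m) j≢u j≢m
  where
  m = suc m₀
  fixρ : FixedPoint (π ++ u ∷ []) j
  fixρ = subst (At 1 (π ++ u ∷ []) j) (trans (sym (swapVal-other y≢q y≢m)) y↦j) atY
  j≢m : j ≢ m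
  j≢m refl = j≢q (CountPerm-position-unique {m} p fixρ atQ)
  j≢u : j ≢ u
  j≢u refl = j≢m (CountPerm-position-unique {m} p fixρ (At-last π j lenπ))

preimage-fixOnlyAt : ∀ m₀ π u → length π ≡ m₀ → CountPerm (suc m₀) (π ++ u ∷ []) →
                     ¬ HasFixedPoint (swapE u (suc m₀) π) → GrowPreimage (suc m₀) ((π ++ u ∷ []) ++ suc (suc m₀) ∷ [])
preimage-fixOnlyAt m₀ π u lenπ p noFix =
  (q , false , σ) , (1≤q , q≤m , lenσ , pσ , q , fixQ) , grow≡
  where
  m = suc m₀
  ρ = π ++ u ∷ []
  lenρ : length ρ ≡ m
  lenρ = trans (length-snoc π u) (cong suc lenπ)
  m∈ρ : 1 ≤ occ m ρ
  m∈ρ = subst (1 ≤_) (sym (trans (p m) (occ-range-inside m m (s≤s z≤n) ≤-refl))) ≤-refl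
  q = proj₁ (occ⇒At 1 m ρ m∈ρ)
  atQ : At 1 ρ q m
  atQ = proj₂ (occ⇒At 1 m ρ m∈ρ)
  1≤q : 1 ≤ q
  1≤q = proj₁ (At-bounds atQ)
  q≤m : q ≤ m
  q≤m = m<1+n⇒m≤n (subst (q <_) (cong suc lenρ) (proj₂ (At-bounds atQ)))
  σ = swapE q m ρ
  lenσ : length σ ≡ m
  lenσ = trans (length-swapE q m ρ) lenρ
  pσ : CountPerm m σ
  pσ = CountPerm-swapE m q m ρ 1≤q q≤m (s≤s z≤n) ≤-refl p
  fixQ : FixedPoint σ q
  fixQ = subst (At 1 σ q) (swapVal-right q m) (At-map (swapVal q m) atQ)
  only : OnlyFixedPoint q σ
  only {j} fix with eqView j q
  ... | equal j≡q _    = j≡q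
  ... | distinct j≢q _ = ⊥-elim (noFix (second-fixed-point⇒HasFixedPoint m₀ π u q j lenπ p atQ fix j≢q))
  grow≡ : grow m (q , false , σ) ≡ ρ ++ suc m ∷ []
  grow≡ = trans (grow-fixOnlyAt q σ lenσ q≤m (OnlyFixedPoint⇒hasFixOther-false q σ only))
                (cong (_++ suc m ∷ []) (swapE-involutive q m ρ))

preimage-lastTop : ∀ m₀ π u → length π ≡ m₀ → CountPerm (suc m₀) (π ++ u ∷ []) →
                   GrowPreimage (suc m₀) ((π ++ u ∷ []) ++ suc (suc m₀) ∷ [])
preimage-lastTop m₀ π u lenπ p with fixedPoint? (swapE u (suc m₀) π)
... | yes fix  = preimage-afterRepeat m₀ π u lenπ p fix
... | no noFix = preimage-fixOnlyAt m₀ π u lenπ p noFix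

grow-surjective : ∀ m τ → 1 ≤ m → FixPerm (suc m) τ → GrowPreimage m τ
grow-surjective m τ _ fτ with initLast τ
grow-surjective m .[] _ (() , _) | []
grow-surjective m .(ρ ++ v ∷ []) _ fτ | ρ ∷ʳ′ v with eqView v (suc m)
... | distinct v≢top _ = preimage-fixElsewhere m ρ v fτ v≢top
grow-surjective (suc m₀) .(ρ ++ suc (suc m₀) ∷ []) _ (len , p , _) | ρ ∷ʳ′ .(suc (suc m₀)) | equal refl _
  with initLast ρ
... | []      = ⊥-elim (0≢1+n (suc-injective len))
... | π ∷ʳ′ u = preimage-lastTop m₀ π u lenπ (CountPerm-unsnoc (suc m₀) (π ++ u ∷ []) p)
  where
  lenπ : length π ≡ m₀
  lenπ = suc-injective (trans (sym (length-snoc π u)) (suc-injective (trans (sym (length-snoc (π ++ u ∷ []) _)) len)))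

grow-bijection : ∀ m → 1 ≤ m → BijectionOnto (GrowDom m) (FixPerm (suc m)) (grow m)
grow-bijection m 1≤m = record
  { into = λ x → grow-into m x 1≤m
  ; inj  = injective
  ; surj = λ τ → grow-surjective m τ 1≤m
  }
  where
  injective : ∀ x y → GrowDom m x → GrowDom m y → grow m x ≡ grow m y → x ≡ y
  injective (w , s) (w′ , s′) (_ , w≤m , adm) (_ , w′≤m , adm′) =
    GrowCase-injective 1≤m w≤m w′≤m adm adm′ (growCase m w s 1≤m w≤m adm) (growCase m w′ s′ 1≤m w′≤m adm′)

-- Inversion sequences avoiding 000

newEntry : ℕ → ℕ → ℕ
newEntry p a = if p <ᵇ a then a else a ∸ 1

letter-self : ∀ p → letter p p ≡ R
letter-self p rewrite ≡ᵇ-refl p = refl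

letter-newEntry : ∀ p a → 1 ≤ a → letter p (newEntry p a) ≡ val a
letter-newEntry p a _ with ltView p a
... | less p<a eq rewrite eq | ≢⇒≡ᵇ-false (>⇒≢ p<a) | eq = refl
letter-newEntry p (suc a) _ | notLess a<p eq rewrite eq | ≢⇒≡ᵇ-false (<⇒≢ a<p) with ltView p a
...   | less p<a _    = ⊥-elim (<-asym p<a a<p)
...   | notLess _ eq′ rewrite eq′ = refl

newEntry≢ : ∀ p a → 1 ≤ a → newEntry p a ≢ p
newEntry≢ p a 1≤a c≡p = R≢val (trans (sym (letter-self p)) (trans (cong (letter p) (sym c≡p)) (letter-newEntry p a 1≤a)))
  where
  R≢val : ∀ {w} → R ≢ val w
  R≢val ()

newEntry≤ : ∀ p a {n} → a ≤ n → newEntry p a ≤ n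
newEntry≤ p a a≤n with p <ᵇ a
... | true  = a≤n
... | false = ≤-trans (m∸n≤m a 1) a≤n

newEntry-onto : ∀ {p c n} → c ≢ p → c ≤ n → p < n → ∃ λ a → 1 ≤ a × a ≤ n × newEntry p a ≡ c
newEntry-onto {p} {c} c≢p c≤n p<n with ltView p c
... | less p<c eq = c , <-≤-trans (s≤s z≤n) p<c , c≤n , cong (λ b → if b then c else c ∸ 1) eq
... | notLess c≤p _ with ltView p (suc c)
...   | less p<1+c _ = ⊥-elim (c≢p (≤-antisym c≤p (m<1+n⇒m≤n p<1+c)))
...   | notLess _ eq = suc c , s≤s z≤n , <⇒≤ (≤-<-trans (≤∧≢⇒< c≤p c≢p) p<n) , cong (λ b → if b then suc c else c) eq

InvFrom : ℕ → List ℕ → Set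
InvFrom i []       = ⊤
InvFrom i (x ∷ xs) = x < i × InvFrom (suc i) xs

avoids000 : List ℕ → Bool
avoids000 (x ∷ y ∷ z ∷ r) = not ((x ≡ᵇ y) ∧ (y ≡ᵇ z)) ∧ avoids000 (y ∷ z ∷ r)
avoids000 _               = true

lastTwoEqual : List ℕ → Bool
lastTwoEqual (x ∷ y ∷ [])    = y ≡ᵇ x
lastTwoEqual (x ∷ y ∷ z ∷ r) = lastTwoEqual (y ∷ z ∷ r)
lastTwoEqual _               = false

InvFrom⇒lookup< : ∀ k e → InvFrom k e → ∀ (i : Fin (length e)) → lookup e i < k + toℕ i
InvFrom⇒lookup< k (x ∷ e) (x<k , _)  fzero    = subst (x <_) (sym (+-identityʳ k)) x<k
InvFrom⇒lookup< k (x ∷ e) (_ , rest) (fsuc i) =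
  subst (lookup e i <_) (sym (+-suc k (toℕ i))) (InvFrom⇒lookup< (suc k) e rest i)

lookup<⇒InvFrom : ∀ k e → (∀ (i : Fin (length e)) → lookup e i < k + toℕ i) → InvFrom k e
lookup<⇒InvFrom k []      _ = tt
lookup<⇒InvFrom k (x ∷ e) h =
  subst (x <_) (+-identityʳ k) (h fzero) ,
  lookup<⇒InvFrom (suc k) e (λ i → subst (lookup e i <_) (+-suc k (toℕ i)) (h (fsuc i)))

avoids000-cons-false : ∀ a e → avoids000 e ≡ false → avoids000 (a ∷ e) ≡ false
avoids000-cons-false a (x ∷ y ∷ z ∷ r) h rewrite h = ∧-zeroʳ _

Has000⇒avoids000-false : ∀ e → Has000 e → avoids000 e ≡ false
Has000⇒avoids000-false _ ([]     , ys , x , refl) rewrite ≡ᵇ-refl x = refl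
Has000⇒avoids000-false _ (a ∷ xs , ys , x , refl) =
  avoids000-cons-false a (xs ++ x ∷ x ∷ x ∷ ys) (Has000⇒avoids000-false _ (xs , ys , x , refl))

∧-true⇒ : ∀ {a b} → (a ∧ b) ≡ true → a ≡ true × b ≡ true
∧-true⇒ {true} {true} _ = refl , refl

Has000-cons : ∀ x {e} → Has000 e → Has000 (x ∷ e)
Has000-cons x (xs , ys , w , eq) = x ∷ xs , ys , w , cong (x ∷_) eq

triple⇒Has000 : ∀ x y z r → ((x ≡ᵇ y) ∧ (y ≡ᵇ z)) ≡ true → Has000 (x ∷ y ∷ z ∷ r)
triple⇒Has000 x y z r eq with ∧-true⇒ eq
... | x≡ᵇy , y≡ᵇz with ≡ᵇ-true⇒≡ {x} x≡ᵇy | ≡ᵇ-true⇒≡ {y} y≡ᵇz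
...   | refl | refl = [] , r , x , refl

avoids000-false⇒Has000 : ∀ e → avoids000 e ≡ false → Has000 e
avoids000-false⇒Has000 (x ∷ y ∷ z ∷ r) h = byTriple _ refl h (avoids000-false⇒Has000 (y ∷ z ∷ r))
  where
  byTriple : ∀ b → ((x ≡ᵇ y) ∧ (y ≡ᵇ z)) ≡ b → (not b ∧ avoids000 (y ∷ z ∷ r)) ≡ false →
             (avoids000 (y ∷ z ∷ r) ≡ false → Has000 (y ∷ z ∷ r)) → Has000 (x ∷ y ∷ z ∷ r)
  byTriple true  eq _ _   = triple⇒Has000 x y z r eq
  byTriple false _  h rec = Has000-cons x (rec h)

Inv000 : ℕ → List ℕ → Set
Inv000 n e = (length e ≡ n) × InvFrom 1 e × (avoids000 e ≡ true)

I000⇒Inv000 : ∀ {n e} → I000 n e → Inv000 n e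
I000⇒Inv000 {n} {e} ((len , inv) , no000) = len , lookup<⇒InvFrom 1 e inv , avoids
  where
  avoids : avoids000 e ≡ true
  avoids with avoids000 e in eq
  ... | true  = refl
  ... | false = ⊥-elim (no000 (avoids000-false⇒Has000 e eq))

Inv000⇒I000 : ∀ {n e} → Inv000 n e → I000 n e
Inv000⇒I000 {n} {e} (len , inv , avoids) = (len , InvFrom⇒lookup< 1 e inv) , noTriple
  where
  noTriple : ¬ Has000 e
  noTriple has with trans (sym (Has000⇒avoids000-false e has)) avoids
  ... | ()

lastℕ-snoc : ∀ e c → lastℕ (e ++ c ∷ []) ≡ c
lastℕ-snoc []          c = refl
lastℕ-snoc (x ∷ [])    c = refl
lastℕ-snoc (x ∷ y ∷ e) c = lastℕ-snoc (y ∷ e) c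

lastTwoEqual-snoc : ∀ x xs c → lastTwoEqual ((x ∷ xs) ++ c ∷ []) ≡ (c ≡ᵇ lastℕ (x ∷ xs))
lastTwoEqual-snoc x []          c = refl
lastTwoEqual-snoc x (y ∷ [])    c = refl
lastTwoEqual-snoc x (y ∷ z ∷ r) c = lastTwoEqual-snoc y (z ∷ r) c

avoids000-snoc : ∀ e c → avoids000 (e ++ c ∷ []) ≡ (avoids000 e ∧ not (lastTwoEqual e ∧ (c ≡ᵇ lastℕ e)))
avoids000-snoc []              c = refl
avoids000-snoc (x ∷ [])        c = refl
avoids000-snoc (x ∷ y ∷ [])    c rewrite ≡ᵇ-sym x y | ≡ᵇ-sym y c = ∧-identityʳ _
avoids000-snoc (x ∷ y ∷ z ∷ r) c rewrite avoids000-snoc (y ∷ z ∷ r) c =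
  sym (∧-assoc (not ((x ≡ᵇ y) ∧ (y ≡ᵇ z))) (avoids000 (y ∷ z ∷ r)) _)

InvFrom-snoc⇒ : ∀ i e c → InvFrom i (e ++ c ∷ []) → InvFrom i e × c < i + length e
InvFrom-snoc⇒ i []      c (c<i , _)  = tt , subst (c <_) (sym (+-identityʳ i)) c<i
InvFrom-snoc⇒ i (x ∷ e) c (x<i , rest) with InvFrom-snoc⇒ (suc i) e c rest
... | inv , c< = (x<i , inv) , subst (c <_) (sym (+-suc i (length e))) c<

InvFrom-snoc⇐ : ∀ i e c → InvFrom i e → c < i + length e → InvFrom i (e ++ c ∷ [])
InvFrom-snoc⇐ i []      c _            c< = subst (c <_) (+-identityʳ i) c< , tt
InvFrom-snoc⇐ i (x ∷ e) c (x<i , rest) c< = x<i , InvFrom-snoc⇐ (suc i) e c rest (subst (c <_) (+-suc i (length e)) c<)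

no-repeat⇒ : ∀ b c p → not (b ∧ (c ≡ᵇ p)) ≡ true → c ≡ p → b ≡ false
no-repeat⇒ false c p _ _ = refl
no-repeat⇒ true  c p h refl rewrite ≡ᵇ-refl c with h
... | ()

no-repeat⇐ : ∀ b c p → (c ≡ p → b ≡ false) → not (b ∧ (c ≡ᵇ p)) ≡ true
no-repeat⇐ false c p _ = refl
no-repeat⇐ true  c p h with eqView c p
... | equal c≡p _ with h c≡p
...   | ()
no-repeat⇐ true  c p h | distinct _ eq rewrite eq = refl

I000-snoc⇒ : ∀ n e c → I000 (suc n) (e ++ c ∷ []) →
             I000 n e × c ≤ n × (c ≡ lastℕ e → lastTwoEqual e ≡ false)
I000-snoc⇒ n e c i with I000⇒Inv000 i
... | len , inv , avoids with InvFrom-snoc⇒ 1 e c inv | ∧-true⇒ (trans (sym (avoids000-snoc e c)) avoids)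
...   | inv′ , c< | avoids′ , noRepeat =
  Inv000⇒I000 (lenₑ , inv′ , avoids′) , m<1+n⇒m≤n (subst (c <_) (cong suc lenₑ) c<) ,
  no-repeat⇒ (lastTwoEqual e) c (lastℕ e) noRepeat
  where
  lenₑ : length e ≡ n
  lenₑ = suc-injective (trans (sym (length-snoc e c)) len)

I000-snoc⇐ : ∀ n e c → I000 n e → c ≤ n → (c ≡ lastℕ e → lastTwoEqual e ≡ false) → I000 (suc n) (e ++ c ∷ [])
I000-snoc⇐ n e c i c≤n noRepeat with I000⇒Inv000 i
... | len , inv , avoids = Inv000⇒I000
  ( trans (length-snoc e c) (cong suc len)
  , InvFrom-snoc⇐ 1 e c inv (subst (c <_) (cong suc (sym len)) (s≤s c≤n))
  , trans (avoids000-snoc e c) (cong₂ _∧_ avoids (no-repeat⇐ (lastTwoEqual e) c (lastℕ e) noRepeat)))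

I000-last< : ∀ n e → I000 n e → 1 ≤ n → lastℕ e < n
I000-last< n e i _ with initLast e
I000-last< (suc n) .[] ((() , _) , _) _ | []
I000-last< n .(e′ ++ c ∷ []) i _ | e′ ∷ʳ′ c with I000⇒Inv000 i
... | len , inv , _ = subst (_< n) (sym (lastℕ-snoc e′ c))
                        (subst (c <_) (trans (sym (length-snoc e′ c)) len) (proj₂ (InvFrom-snoc⇒ 1 e′ c inv)))

I000-one : ∀ e → I000 1 e → e ≡ 0 ∷ []
I000-one e i with I000⇒Inv000 i
I000-one (zero ∷ [])      i | _ = refl
I000-one (suc x ∷ [])     i | _ , (s≤s () , _) , _
I000-one (x ∷ y ∷ e)      i | () , _

I000-zero : I000 1 (0 ∷ [])
I000-zero = Inv000⇒I000 (refl , (s≤s z≤n , tt) , refl)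

-- φ, one entry at a time

-- The letter w_{k-1} seen by phiAux when it reaches the end of cs.
prevLetter : Letter → ℕ → List ℕ → Letter
prevLetter q p []       = q
prevLetter q p (c ∷ cs) = prevLetter (letter p c) c cs

phiAux-snoc : ∀ k q p cs c σ → phiAux k q p (cs ++ c ∷ []) σ ≡
              step (k + length cs) (prevLetter q p cs) (letter (lastℕ (p ∷ cs)) c) (phiAux k q p cs σ)
phiAux-snoc k q p []        c σ rewrite +-identityʳ k = refl
phiAux-snoc k q p (c′ ∷ cs) c σ rewrite +-suc k (length cs) = phiAux-snoc (suc k) (letter p c′) c′ cs c _

isR-letter : ∀ p c → isR (letter p c) ≡ (c ≡ᵇ p)
isR-letter p c with c ≡ᵇ p
... | true  = refl
... | false with p <ᵇ c
...   | true  = refl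
...   | false = refl

isR-prevLetter : ∀ x xs → isR (prevLetter (val 0) x xs) ≡ lastTwoEqual (x ∷ xs)
isR-prevLetter x []       = refl
isR-prevLetter x (c ∷ cs) = go x c cs
  where
  go : ∀ p c cs → isR (prevLetter (letter p c) c cs) ≡ lastTwoEqual (p ∷ c ∷ cs)
  go p c []       = isR-letter p c
  go p c (d ∷ ds) = go c d ds

step-isR : ∀ k prev L σ → step k prev L σ ≡ step k (if isR prev then R else val 0) L σ
step-isR k R       R       σ = refl
step-isR k R       (val x) σ = refl
step-isR k (val y) R       σ = refl
step-isR k (val y) (val x) σ = refl

φ-snoc : ∀ x xs c → φ ((x ∷ xs) ++ c ∷ []) ≡
         step (suc (length (x ∷ xs))) (if lastTwoEqual (x ∷ xs) then R else val 0) (letter (lastℕ (x ∷ xs)) c) (φ (x ∷ xs))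
φ-snoc x xs c = begin
  phiAux 2 (val 0) x (xs ++ c ∷ []) (1 ∷ [])
    ≡⟨ phiAux-snoc 2 (val 0) x xs c (1 ∷ []) ⟩
  step k (prevLetter (val 0) x xs) L σ
    ≡⟨ step-isR k (prevLetter (val 0) x xs) L σ ⟩
  step k (if isR (prevLetter (val 0) x xs) then R else val 0) L σ
    ≡⟨ cong (λ b → step k (if b then R else val 0) L σ) (isR-prevLetter x xs) ⟩
  step k (if lastTwoEqual (x ∷ xs) then R else val 0) L σ ∎
  where
  k = suc (length (x ∷ xs))
  L = letter (lastℕ (x ∷ xs)) c
  σ = φ (x ∷ xs)

φ-repeat : ∀ x xs → φ ((x ∷ xs) ++ lastℕ (x ∷ xs) ∷ []) ≡ φ (x ∷ xs)
φ-repeat x xs = trans (φ-snoc x xs _)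
  (cong (λ L → step _ (if lastTwoEqual (x ∷ xs) then R else val 0) L (φ (x ∷ xs))) (letter-self (lastℕ (x ∷ xs))))

φ-ext : ∀ a x xs → 1 ≤ a → φ (ext a (x ∷ xs)) ≡ grow (length (x ∷ xs)) (a , lastTwoEqual (x ∷ xs) , φ (x ∷ xs))
φ-ext a x xs 1≤a = trans (φ-snoc x xs _)
  (cong (λ L → step _ (if lastTwoEqual (x ∷ xs) then R else val 0) L (φ (x ∷ xs))) (letter-newEntry (lastℕ (x ∷ xs)) a 1≤a))

lastTwoEqual-ext : ∀ a x xs → 1 ≤ a → lastTwoEqual (ext a (x ∷ xs)) ≡ false
lastTwoEqual-ext a x xs 1≤a = trans (lastTwoEqual-snoc x xs _) (≢⇒≡ᵇ-false (newEntry≢ (lastℕ (x ∷ xs)) a 1≤a))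

lastTwoEqual-repeat : ∀ x xs → lastTwoEqual ((x ∷ xs) ++ lastℕ (x ∷ xs) ∷ []) ≡ true
lastTwoEqual-repeat x xs = trans (lastTwoEqual-snoc x xs _) (≡ᵇ-refl (lastℕ (x ∷ xs)))

ext-I000 : ∀ n a e → Dom n (a , e) → I000 (suc n) (ext a e)
ext-I000 n a e (1≤a , a≤n , i) =
  I000-snoc⇐ n e _ i (newEntry≤ (lastℕ e) a a≤n) (λ c≡p → ⊥-elim (newEntry≢ (lastℕ e) a 1≤a c≡p))

ext-LastTwoDistinct : ∀ n a e → 1 ≤ n → Dom n (a , e) → LastTwoDistinct (ext a e)
ext-LastTwoDistinct n a e _ (1≤a , _ , i) with initLast e
ext-LastTwoDistinct (suc n) a .[] _ (_ , _ , (() , _) , _) | []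
ext-LastTwoDistinct n a .(e₀ ++ p ∷ []) _ (1≤a , _ , _) | e₀ ∷ʳ′ p =
  e₀ , p , newEntry (lastℕ (e₀ ++ p ∷ [])) a , ++-assoc e₀ (p ∷ []) _ ,
  λ p≡c → newEntry≢ (lastℕ (e₀ ++ p ∷ [])) a 1≤a (trans (sym p≡c) (sym (lastℕ-snoc e₀ p)))

ext-injective : ∀ a a′ e e′ → 1 ≤ a → 1 ≤ a′ → ext a e ≡ ext a′ e′ → (a , e) ≡ (a′ , e′)
ext-injective a a′ e e′ 1≤a 1≤a′ eq with ∷ʳ-injective e e′ eq
... | refl , c≡c′ = cong (_, e) (val-injective (begin
  val a                                  ≡⟨ letter-newEntry (lastℕ e) a 1≤a ⟨
  letter (lastℕ e) (newEntry (lastℕ e) a)  ≡⟨ cong (letter (lastℕ e)) c≡c′ ⟩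
  letter (lastℕ e) (newEntry (lastℕ e) a′) ≡⟨ letter-newEntry (lastℕ e) a′ 1≤a′ ⟩
  val a′                                 ∎))
  where
  val-injective : ∀ {x y} → val x ≡ val y → x ≡ y
  val-injective refl = refl

ext-onto : ∀ n e c → 1 ≤ n → I000 (suc n) (e ++ c ∷ []) → c ≢ lastℕ e → ∃ λ a → Dom n (a , e) × ext a e ≡ e ++ c ∷ []
ext-onto n e c 1≤n i c≢p with I000-snoc⇒ n e c i
... | iₑ , c≤n , _ with newEntry-onto c≢p c≤n (I000-last< n e iₑ 1≤n)
...   | a , 1≤a , a≤n , eq = a , (1≤a , a≤n , iₑ) , cong (λ c′ → e ++ c′ ∷ []) eq

ext-bijection : ∀ n → 1 ≤ n →
  BijectionOnto (Dom n) (λ e′ → I000 (suc n) e′ × LastTwoDistinct e′) (λ p → ext (proj₁ p) (proj₂ p))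
ext-bijection n 1≤n = record
  { into = λ { (a , e) d → ext-I000 n a e d , ext-LastTwoDistinct n a e 1≤n d }
  ; inj  = λ { (a , e) (a′ , e′) (1≤a , _) (1≤a′ , _) → ext-injective a a′ e e′ 1≤a 1≤a′ }
  ; surj = surj
  }
  where
  surj : ∀ y → I000 (suc n) y × LastTwoDistinct y → Σ (ℕ × List ℕ) λ x → Dom n x × ext (proj₁ x) (proj₂ x) ≡ y
  surj y (i , xs , p , c , refl , p≢c) with ext-onto n (xs ++ p ∷ []) c 1≤n i′ c≢p
    where
    i′ : I000 (suc n) ((xs ++ p ∷ []) ++ c ∷ [])
    i′ = subst (I000 (suc n)) (sym (++-assoc xs (p ∷ []) (c ∷ []))) i
    c≢p : c ≢ lastℕ (xs ++ p ∷ [])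
    c≢p c≡ = p≢c (sym (trans c≡ (lastℕ-snoc xs p)))
  ... | a , d , eq = (a , xs ++ p ∷ []) , d , trans eq (++-assoc xs (p ∷ []) (c ∷ []))

data Extension (n : ℕ) : List ℕ → Set where
  repeatLast : ∀ {e} → I000 n e → lastTwoEqual e ≡ false → Extension n (e ++ lastℕ e ∷ [])
  extend     : ∀ {a e} → Dom n (a , e) → Extension n (ext a e)

extension : ∀ n e → 1 ≤ n → I000 (suc n) e → Extension n e
extension n e 1≤n i with initLast e
extension n .[] 1≤n ((() , _) , _) | []
extension n .(e′ ++ c ∷ []) 1≤n i | e′ ∷ʳ′ c with eqView c (lastℕ e′)
... | equal refl _    = repeatLast (proj₁ (I000-snoc⇒ n e′ c i)) (proj₂ (proj₂ (I000-snoc⇒ n e′ c i)) refl)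
... | distinct c≢p _ with ext-onto n e′ c 1≤n i c≢p
...   | a , d , eq = subst (Extension n) eq (extend d)

-- lastTwoEqual e says whether the last letter of the word of e is R.
φ̂ : List ℕ → Bool × List ℕ
φ̂ e = lastTwoEqual e , φ e

φ̂-repeat : ∀ n e → 1 ≤ n → I000 n e → φ̂ (e ++ lastℕ e ∷ []) ≡ (true , φ e)
φ̂-repeat (suc n) []       _ ((() , _) , _)
φ̂-repeat n       (x ∷ xs) _ _ = cong₂ _,_ (lastTwoEqual-repeat x xs) (φ-repeat x xs)

φ̂-ext : ∀ n a e → Dom n (a , e) → 1 ≤ n → φ̂ (ext a e) ≡ (false , grow n (a , φ̂ e))
φ̂-ext (suc n) a []       (_ , _ , (() , _) , _) _
φ̂-ext n       a (x ∷ xs) (1≤a , _ , (refl , _) , _) _ = cong₂ _,_ (lastTwoEqual-ext a x xs 1≤a) (φ-ext a x xs 1≤a)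

φ̂-bijection-one : BijectionOnto (I000 1) (Admissible 1) φ̂
φ̂-bijection-one = record { into = into ; inj = inj ; surj = surj }
  where
  into : ∀ e → I000 1 e → Admissible 1 (φ̂ e)
  into e i rewrite I000-one e i = refl , (λ v → refl) , 1 , here
  inj : ∀ e e′ → I000 1 e → I000 1 e′ → φ̂ e ≡ φ̂ e′ → e ≡ e′
  inj e e′ i i′ _ = trans (I000-one e i) (sym (I000-one e′ i′))
  surj : ∀ s → Admissible 1 s → Σ (List ℕ) λ e → I000 1 e × φ̂ e ≡ s
  surj (true  , [])     (_ , _ , _ , ())
  surj (false , _ ∷ []) (_ , _ , _ , here) = 0 ∷ [] , I000-zero , refl
  surj (false , _ ∷ []) (_ , _ , _ , there ())

φ̂-bijection-suc : ∀ n → 1 ≤ n → BijectionOnto (I000 n) (Admissible n) φ̂ →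
                  BijectionOnto (I000 (suc n)) (Admissible (suc n)) φ̂
φ̂-bijection-suc n 1≤n ih = record { into = into ; inj = inj ; surj = surj }
  where
  module IH = BijectionOnto ih
  module G  = BijectionOnto (grow-bijection n 1≤n)

  dom : ∀ {a e} → Dom n (a , e) → GrowDom n (a , φ̂ e)
  dom {a} {e} (1≤a , a≤n , i) = 1≤a , a≤n , IH.into e i

  into : ∀ e → I000 (suc n) e → Admissible (suc n) (φ̂ e)
  into e i with extension n e 1≤n i
  ... | repeatLast {e′} i′ notEqual rewrite φ̂-repeat n e′ 1≤n i′ =
    subst (λ b → Admissible n (b , φ e′)) notEqual (IH.into e′ i′)
  ... | extend {a} {e′} d rewrite φ̂-ext n a e′ d 1≤n = G.into (a , φ̂ e′) (dom d)

  inj : ∀ e f → I000 (suc n) e → I000 (suc n) f → φ̂ e ≡ φ̂ f → e ≡ f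
  inj e f iₑ i_f eq with extension n e 1≤n iₑ | extension n f 1≤n i_f
  ... | repeatLast {e′} i′ l | repeatLast {f′} j′ l′ =
    cong (λ x → x ++ lastℕ x ∷ []) (IH.inj e′ f′ i′ j′ (cong₂ _,_ (trans l (sym l′)) (cong proj₂ φ≡)))
    where
    φ≡ : (true , φ e′) ≡ (true , φ f′)
    φ≡ = trans (sym (φ̂-repeat n e′ 1≤n i′)) (trans eq (φ̂-repeat n f′ 1≤n j′))
  ... | repeatLast {e′} i′ _ | extend {a′} {f′} d′ with trans (sym (φ̂-repeat n e′ 1≤n i′)) (trans eq (φ̂-ext n a′ f′ d′ 1≤n))
  ...   | ()
  inj e f iₑ i_f eq | extend {a} {e′} d | repeatLast {f′} j′ _ with trans (sym (φ̂-ext n a e′ d 1≤n)) (trans eq (φ̂-repeat n f′ 1≤n j′))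
  ...   | ()
  inj e f iₑ i_f eq | extend {a} {e′} d@(_ , _ , i′) | extend {a′} {f′} d′@(_ , _ , j′)
    with G.inj (a , φ̂ e′) (a′ , φ̂ f′) (dom d) (dom d′) (cong proj₂ (trans (sym (φ̂-ext n a e′ d 1≤n)) (trans eq (φ̂-ext n a′ f′ d′ 1≤n))))
  ...   | same = cong₂ ext (cong proj₁ same) (IH.inj e′ f′ i′ j′ (cong proj₂ same))

  surj : ∀ s → Admissible (suc n) s → Σ (List ℕ) λ e → I000 (suc n) e × φ̂ e ≡ s
  surj (true , σ) adm with IH.surj (false , σ) adm
  ... | e′ , i′ , eq =
    e′ ++ lastℕ e′ ∷ [] , I000-snoc⇐ n e′ _ i′ (<⇒≤ (I000-last< n e′ i′ 1≤n)) (λ _ → cong proj₁ eq) ,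
    trans (φ̂-repeat n e′ 1≤n i′) (cong (true ,_) (cong proj₂ eq))
  surj (false , τ) adm with G.surj τ adm
  ... | (a , s) , (1≤a , a≤n , adm′) , eq with IH.surj s adm′
  ...   | e′ , i′ , refl = ext a e′ , ext-I000 n a e′ d , trans (φ̂-ext n a e′ d 1≤n) (cong (false ,_) eq)
    where
    d : Dom n (a , e′)
    d = 1≤a , a≤n , i′

φ̂-bijection : ∀ n → 1 ≤ n → BijectionOnto (I000 n) (Admissible n) φ̂
φ̂-bijection (suc zero)    _ = φ̂-bijection-one
φ̂-bijection (suc (suc n)) _ = φ̂-bijection-suc (suc n) (s≤s z≤n) (φ̂-bijection (suc n) (s≤s z≤n))

Dom-bijection : ∀ n → 1 ≤ n → BijectionOnto (Dom n) (GrowDom n) (map₂ φ̂)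
Dom-bijection n 1≤n = record { into = into ; inj = inj ; surj = surj }
  where
  module Φ = BijectionOnto (φ̂-bijection n 1≤n)
  into : ∀ x → Dom n x → GrowDom n (map₂ φ̂ x)
  into (a , e) (1≤a , a≤n , i) = 1≤a , a≤n , Φ.into e i
  inj : ∀ x y → Dom n x → Dom n y → map₂ φ̂ x ≡ map₂ φ̂ y → x ≡ y
  inj (a , e) (a′ , e′) (_ , _ , i) (_ , _ , i′) eq = cong₂ _,_ (cong proj₁ eq) (Φ.inj e e′ i i′ (cong proj₂ eq))
  surj : ∀ y → GrowDom n y → Σ (ℕ × List ℕ) λ x → Dom n x × map₂ φ̂ x ≡ y
  surj (a , s) (1≤a , a≤n , adm) with Φ.surj s adm
  ... | e , i , φ̂e≡s = (a , e) , (1≤a , a≤n , i) , cong (a ,_) φ̂e≡s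

mainTheorem2 : (n : ℕ) → 1 ≤ n →
    ((a : ℕ) (e : List ℕ) → Dom n (a , e) → I000 (suc n) (ext a e))
    × BijectionOnto (Dom n) (λ e′ → I000 (suc n) e′ × LastTwoDistinct e′) (λ p → ext (proj₁ p) (proj₂ p))
    × BijectionOnto (Dom n) (Dbar (suc n)) (λ p → φ (ext (proj₁ p) (proj₂ p)))
mainTheorem2 n 1≤n = ext-I000 n , ext-bijection n 1≤n , φ∘ext-bijection
  where
  grow∘φ̂≡φ∘ext : ∀ x → Dom n x → grow n (map₂ φ̂ x) ≡ φ (ext (proj₁ x) (proj₂ x))
  grow∘φ̂≡φ∘ext (a , e) d = sym (cong proj₂ (φ̂-ext n a e d 1≤n))
  φ∘ext-bijection : BijectionOnto (Dom n) (Dbar (suc n)) (λ p → φ (ext (proj₁ p) (proj₂ p)))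
  φ∘ext-bijection =
    BijectionOnto-cong grow∘φ̂≡φ∘ext
      (BijectionOnto-codomain (FixPerm⇒Dbar (suc n)) (Dbar⇒FixPerm (suc n))
        (BijectionOnto-∘ (Dom-bijection n 1≤n) (grow-bijection n 1≤n)))
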